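{- Define the Bell numbers of the second kind $\mathrm{bel}_n$ ($n\ge 1$) by \[ \log\big(1+\log(1+t)\big)=\sum_{n=1}^{\infty}\mathrm{bel}_{n}\frac{t^{n}}{n!}. \] Then $\mathrm{bel}_1=1$, and for every $n\ge 2$, \[ \sum_{j=1}^{n}\sum_{k=1}^{j}\mathrm{bel}_{k}S_{2}(j,k)S_{2}(n,j)=0. \]
   Context: The Stirling numbers of the second kind are given by $\frac{1}{k!}(e^t-1)^k=\sum_{n\ge k}S_2(n,k)\frac{t^n}{n!}$. All series are formal power series. -}

module Defs where

open import Data.Nat as ℕ using (ℕ; zero; suc; _∸_)
open import Data.Nat using (_!)
open import Data.Nat.Properties using (_!≢0)
open import Data.Integer as ℤ using (+_; -[1+_])
open import Data.Rational using (ℚ; 0ℚ; 1ℚ; _+_; _*_; _/_)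

-- Formal power series over ℚ, represented by their coefficient sequences.
Series : Set
Series = ℕ → ℚ

∑≤ : ℕ → (ℕ → ℚ) → ℚ
∑≤ zero    f = f 0
∑≤ (suc n) f = ∑≤ n f + f (suc n)

∑₁ : ℕ → (ℕ → ℚ) → ℚ
∑₁ zero    f = 0ℚ
∑₁ (suc n) f = ∑₁ n f + f (suc n)

one : Series
one zero    = 1ℚ
one (suc _) = 0ℚ

X : Series
X 1 = 1ℚ
X _ = 0ℚ

_⊛_ : Series → Series → Series
(f ⊛ g) n = ∑≤ n (λ i → f i * g (n ∸ i))

pow : Series → ℕ → Series
pow f zero    = one
pow f (suc m) = f ⊛ pow f m

-- coefficients of log(1+t) = Σ_{m≥1} (-1)^{m+1} t^m / m
logCoeff : ℕ → ℚ
logCoeff zero    = 0ℚ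
logCoeff (suc m) with m ℕ.% 2
... | zero  = (+ 1) / suc m
... | suc _ = -[1+ 0 ] / suc m

-- composition log(1+u) for a series u with zero constant term:
-- [t^n] log(1+u) = Σ_{m=0}^{n} logCoeff m · [t^n] u^m
-- (terms with m > n vanish when u(0) = 0, so this truncation is exact).
log1+ : Series → Series
log1+ u n = ∑≤ n (λ m → logCoeff m * pow u m n)

-- coefficients of e^t - 1
expm1 : Series
expm1 zero    = 0ℚ
expm1 (suc n) = _/_ (+ 1) (suc n !) ⦃ suc n !≢0 ⦄

fact : ℕ → ℚ
fact n = (+ (n !)) / 1

-- Stirling numbers of the second kind via
-- (1/k!)(e^t-1)^k = Σ_n S₂(n,k) t^n / n!
S₂ : ℕ → ℕ → ℚ
S₂ n k = fact n * (_/_ (+ 1) (k !) ⦃ k !≢0 ⦄ * pow expm1 k n)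

bel : ℕ → ℚ
bel n = fact n * log1+ (log1+ X) n

{-# OPTIONS --safe #-}
module Submission where

-- Write L = log(1+t) and E = eᵗ − 1.  Since log(1 + E) = t, the
-- coefficient matrices [tᵏ] Lᵐ and [tʲ] Eᵏ are inverse to each other; this is
-- proved by comparing the recursions that (1+t)(Lᵐ)′ = m Lᵐ⁻¹ and
-- (Eᵏ)′ = k (Eᵏ⁻¹ + Eᵏ) impose on them.  Hence substituting E into any series
-- of the form f(L) gives back f; for f = log(1+t) this says
-- Σₖ belₖ S₂(j,k) = j! [tʲ] L, and then Σⱼ j! [tʲ] L · S₂(n,j) = n! [tⁿ] L(E) = n! [tⁿ] t,
-- which vanishes for n ≥ 2.

open import Defs
open import Data.Nat using (ℕ; _≤_)
open import Data.Product using (_×_)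
open import Data.Rational using (0ℚ; 1ℚ; _*_)
open import Relation.Binary.PropositionalEquality using (_≡_)

open import Algebra.Bundles using (CommutativeMonoid)
import Algebra.Properties.CommutativeSemigroup as CommSemigroupProperties
import Algebra.Properties.Group as GroupProperties
open import Data.Nat as ℕ using (zero; suc; _∸_; _<_; z≤n; s≤s; _!; NonZero)
import Data.Nat.Properties as ℕₚ
open import Data.Nat.Coprimality as Coprimality using (Coprime; 1-coprimeTo)
open import Data.Nat.DivMod using ([m+n]%n≡m%n)
open import Data.Integer as ℤ using (+_)
import Data.Integer.Properties as ℤₚ
open import Data.Product using (_,_)
open import Data.Empty using (⊥-elim)
open import Data.Sum using (inj₁; inj₂)
open import Data.Rational using (ℚ; mkℚ; _+_; -_; _/_)
open import Data.Rational.Properties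
open import Data.Rational.Solver using (module +-*-Solver)
open import Data.Rational.Unnormalised using (*≡*)
import Data.Rational.Unnormalised.Properties as ℚᵘ
open import Relation.Binary.PropositionalEquality
  using (_≗_; refl; sym; trans; cong; cong₂; module ≡-Reasoning)
open import Relation.Nullary using (yes; no; ¬_)

open +-*-Solver using (solve; _:+_; _:*_; _:=_)
module +-CS = CommSemigroupProperties (CommutativeMonoid.commutativeSemigroup +-0-commutativeMonoid)
module *-CS = CommSemigroupProperties (CommutativeMonoid.commutativeSemigroup *-1-commutativeMonoid)
open GroupProperties +-0-group using (⁻¹-involutive)

fromℕ : ℕ → ℚ
fromℕ n = + n / 1

coprimeTo1 : ∀ n → Coprime n 1
coprimeTo1 n = Coprimality.sym (1-coprimeTo n)

fromℕ≡mkℚ : ∀ n → fromℕ n ≡ mkℚ (+ n) 0 (coprimeTo1 n)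
fromℕ≡mkℚ n = normalize-coprime (coprimeTo1 n)

fromℕ-suc : ∀ n → fromℕ (suc n) ≡ 1ℚ + fromℕ n
fromℕ-suc n rewrite fromℕ≡mkℚ n | fromℕ≡mkℚ (suc n) =
  toℚᵘ-injective (ℚᵘ.≃-sym (ℚᵘ.≃-trans (toℚᵘ-homo-+ 1ℚ (mkℚ (+ n) 0 (coprimeTo1 n)))
    (*≡* (cong (λ x → (+ 1 ℤ.+ x) ℤ.* + 1) (ℤₚ.*-identityʳ (+ n))))))

fromℕ-+ : ∀ m n → fromℕ (m ℕ.+ n) ≡ fromℕ m + fromℕ n
fromℕ-+ zero    n = sym (+-identityˡ (fromℕ n))
fromℕ-+ (suc m) n = begin
  fromℕ (suc (m ℕ.+ n))        ≡⟨ fromℕ-suc (m ℕ.+ n) ⟩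
  1ℚ + fromℕ (m ℕ.+ n)         ≡⟨ cong (_+_ 1ℚ) (fromℕ-+ m n) ⟩
  1ℚ + (fromℕ m + fromℕ n)     ≡⟨ +-assoc 1ℚ (fromℕ m) (fromℕ n) ⟨
  (1ℚ + fromℕ m) + fromℕ n     ≡⟨ cong (_+ fromℕ n) (fromℕ-suc m) ⟨
  fromℕ (suc m) + fromℕ n      ∎
  where open ≡-Reasoning

fromℕ-* : ∀ m n → fromℕ (m ℕ.* n) ≡ fromℕ m * fromℕ n
fromℕ-* zero    n = sym (*-zeroˡ (fromℕ n))
fromℕ-* (suc m) n = begin
  fromℕ (n ℕ.+ m ℕ.* n)               ≡⟨ fromℕ-+ n (m ℕ.* n) ⟩
  fromℕ n + fromℕ (m ℕ.* n)           ≡⟨ cong₂ _+_ (*-identityˡ (fromℕ n)) (sym (fromℕ-* m n)) ⟨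
  1ℚ * fromℕ n + fromℕ m * fromℕ n    ≡⟨ *-distribʳ-+ (fromℕ n) 1ℚ (fromℕ m) ⟨
  (1ℚ + fromℕ m) * fromℕ n            ≡⟨ cong (_* fromℕ n) (fromℕ-suc m) ⟨
  fromℕ (suc m) * fromℕ n             ∎
  where open ≡-Reasoning

fromℕ-suc-* : ∀ m x → fromℕ (suc m) * x ≡ x + fromℕ m * x
fromℕ-suc-* m x = begin
  fromℕ (suc m) * x      ≡⟨ cong (_* x) (fromℕ-suc m) ⟩
  (1ℚ + fromℕ m) * x     ≡⟨ *-distribʳ-+ x 1ℚ (fromℕ m) ⟩
  1ℚ * x + fromℕ m * x   ≡⟨ cong (_+ fromℕ m * x) (*-identityˡ x) ⟩
  x + fromℕ m * x        ∎
  where open ≡-Reasoning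

fromℕ[n]*1/n≡1 : ∀ n .{{_ : NonZero n}} → fromℕ n * (+ 1 / n) ≡ 1ℚ
fromℕ[n]*1/n≡1 (suc n)
  rewrite fromℕ≡mkℚ (suc n) | normalize-coprime {1} {n} (1-coprimeTo (suc n)) =
  *-inverseʳ (mkℚ (+ suc n) 0 (coprimeTo1 (suc n)))

fromℕ[m]*1/[m*n]≡1/n : ∀ m n .{{_ : NonZero m}} .{{_ : NonZero n}} →
                       fromℕ m * (+ 1 / (m ℕ.* n)) {{ℕₚ.m*n≢0 m n}} ≡ + 1 / n
fromℕ[m]*1/[m*n]≡1/n m n = begin
  fromℕ m * u                          ≡⟨ *-identityʳ (fromℕ m * u) ⟨
  (fromℕ m * u) * 1ℚ                   ≡⟨ cong ((fromℕ m * u) *_) (fromℕ[n]*1/n≡1 n) ⟨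
  (fromℕ m * u) * (fromℕ n * v)        ≡⟨ solve 4 (λ a b u v → (a :* u) :* (b :* v) := (a :* b :* u) :* v) refl
                                                  (fromℕ m) (fromℕ n) u v ⟩
  (fromℕ m * fromℕ n * u) * v          ≡⟨ cong (λ x → (x * u) * v) (fromℕ-* m n) ⟨
  (fromℕ (m ℕ.* n) * u) * v            ≡⟨ cong (_* v) (fromℕ[n]*1/n≡1 (m ℕ.* n) {{ℕₚ.m*n≢0 m n}}) ⟩
  1ℚ * v                               ≡⟨ *-identityˡ v ⟩
  v                                    ∎
  where
  open ≡-Reasoning
  u = (+ 1 / (m ℕ.* n)) {{ℕₚ.m*n≢0 m n}}
  v = + 1 / n

fromℕ-suc-*-cancelˡ : ∀ n {x y} → fromℕ (suc n) * x ≡ fromℕ (suc n) * y → x ≡ y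
fromℕ-suc-*-cancelˡ n {x} {y} eq = trans (sym (undo x)) (trans (cong (u *_) eq) (undo y))
  where
  u = + 1 / suc n
  undo : ∀ z → u * (fromℕ (suc n) * z) ≡ z
  undo z = begin
    u * (fromℕ (suc n) * z)   ≡⟨ *-assoc u (fromℕ (suc n)) z ⟨
    (u * fromℕ (suc n)) * z   ≡⟨ cong (_* z) (trans (*-comm u (fromℕ (suc n))) (fromℕ[n]*1/n≡1 (suc n))) ⟩
    1ℚ * z                    ≡⟨ *-identityˡ z ⟩
    z                         ∎
    where open ≡-Reasoning

-- Finite sums

∑≤-cong : ∀ n {f g : ℕ → ℚ} → (∀ i → i ≤ n → f i ≡ g i) → ∑≤ n f ≡ ∑≤ n g
∑≤-cong zero    eq = eq 0 z≤n
∑≤-cong (suc n) eq = cong₂ _+_ (∑≤-cong n (λ i i≤n → eq i (ℕₚ.m≤n⇒m≤1+n i≤n))) (eq (suc n) ℕₚ.≤-refl)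

∑≤-zero : ∀ n {f : ℕ → ℚ} → (∀ i → i ≤ n → f i ≡ 0ℚ) → ∑≤ n f ≡ 0ℚ
∑≤-zero zero    eq = eq 0 z≤n
∑≤-zero (suc n) eq =
  trans (cong₂ _+_ (∑≤-zero n (λ i i≤n → eq i (ℕₚ.m≤n⇒m≤1+n i≤n))) (eq (suc n) ℕₚ.≤-refl)) (+-identityʳ 0ℚ)

∑≤-distrib-+ : ∀ n (f g : ℕ → ℚ) → ∑≤ n (λ i → f i + g i) ≡ ∑≤ n f + ∑≤ n g
∑≤-distrib-+ zero    f g = refl
∑≤-distrib-+ (suc n) f g =
  trans (cong (_+ (f (suc n) + g (suc n))) (∑≤-distrib-+ n f g))
        (+-CS.interchange (∑≤ n f) (∑≤ n g) (f (suc n)) (g (suc n)))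

*-distribˡ-∑≤ : ∀ n c (f : ℕ → ℚ) → c * ∑≤ n f ≡ ∑≤ n (λ i → c * f i)
*-distribˡ-∑≤ zero    c f = refl
*-distribˡ-∑≤ (suc n) c f =
  trans (*-distribˡ-+ c (∑≤ n f) (f (suc n))) (cong (_+ c * f (suc n)) (*-distribˡ-∑≤ n c f))

*-distribʳ-∑≤ : ∀ n c (f : ℕ → ℚ) → ∑≤ n f * c ≡ ∑≤ n (λ i → f i * c)
*-distribʳ-∑≤ n c f =
  trans (*-comm (∑≤ n f) c) (trans (*-distribˡ-∑≤ n c f) (∑≤-cong n (λ i _ → *-comm c (f i))))

∑≤-suc : ∀ n (f : ℕ → ℚ) → ∑≤ (suc n) f ≡ f 0 + ∑≤ n (λ i → f (suc i))
∑≤-suc zero    f = refl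
∑≤-suc (suc n) f =
  trans (cong (_+ f (suc (suc n))) (∑≤-suc n f)) (+-assoc (f 0) (∑≤ n (λ i → f (suc i))) (f (suc (suc n))))

∑≤-comm : ∀ m n (F : ℕ → ℕ → ℚ) → ∑≤ m (λ i → ∑≤ n (F i)) ≡ ∑≤ n (λ j → ∑≤ m (λ i → F i j))
∑≤-comm zero    n F = refl
∑≤-comm (suc m) n F =
  trans (cong (_+ ∑≤ n (F (suc m))) (∑≤-comm m n F))
        (sym (∑≤-distrib-+ n (λ j → ∑≤ m (λ i → F i j)) (F (suc m))))

∑≤-extend : ∀ {m n} (f : ℕ → ℚ) → m ≤ n → (∀ i → m < i → f i ≡ 0ℚ) → ∑≤ m f ≡ ∑≤ n f
∑≤-extend {n = zero}  f z≤n   _    = refl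
∑≤-extend {m} {suc n} f m≤1+n vanish with ℕₚ.m≤n⇒m<n∨m≡n m≤1+n
... | inj₂ refl       = refl
... | inj₁ (s≤s m≤n) = begin
  ∑≤ m f                   ≡⟨ ∑≤-extend f m≤n vanish ⟩
  ∑≤ n f                   ≡⟨ +-identityʳ (∑≤ n f) ⟨
  ∑≤ n f + 0ℚ              ≡⟨ cong (_+_ (∑≤ n f)) (vanish (suc n) (s≤s m≤n)) ⟨
  ∑≤ n f + f (suc n)       ∎
  where open ≡-Reasoning

∑≤-telescope : ∀ n {x p g : ℕ → ℚ} → (∀ i → i ≤ n → x i + g i ≡ p i + g (suc i)) →
               ∑≤ n x + g 0 ≡ ∑≤ n p + g (suc n)
∑≤-telescope zero    step = step 0 z≤n
∑≤-telescope (suc n) {x} {p} {g} step = begin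
  (∑≤ n x + x (suc n)) + g 0             ≡⟨ +-CS.xy∙z≈xz∙y (∑≤ n x) (x (suc n)) (g 0) ⟩
  (∑≤ n x + g 0) + x (suc n)             ≡⟨ cong (_+ x (suc n)) (∑≤-telescope n (λ i i≤n → step i (ℕₚ.m≤n⇒m≤1+n i≤n))) ⟩
  (∑≤ n p + g (suc n)) + x (suc n)       ≡⟨ +-CS.xy∙z≈x∙zy (∑≤ n p) (g (suc n)) (x (suc n)) ⟩
  ∑≤ n p + (x (suc n) + g (suc n))       ≡⟨ cong (_+_ (∑≤ n p)) (step (suc n) ℕₚ.≤-refl) ⟩
  ∑≤ n p + (p (suc n) + g (suc (suc n))) ≡⟨ +-assoc (∑≤ n p) (p (suc n)) (g (suc (suc n))) ⟨
  (∑≤ n p + p (suc n)) + g (suc (suc n)) ∎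
  where open ≡-Reasoning

∑≤-telescope-vanishing : ∀ n {x p g : ℕ → ℚ} → g 0 ≡ 0ℚ → g (suc n) ≡ 0ℚ →
                         (∀ i → i ≤ n → x i + g i ≡ p i + g (suc i)) → ∑≤ n x ≡ ∑≤ n p
∑≤-telescope-vanishing n {x} {p} {g} g₀≡0 gₙ₊₁≡0 step = begin
  ∑≤ n x               ≡⟨ +-identityʳ (∑≤ n x) ⟨
  ∑≤ n x + 0ℚ          ≡⟨ cong (_+_ (∑≤ n x)) g₀≡0 ⟨
  ∑≤ n x + g 0         ≡⟨ ∑≤-telescope n step ⟩
  ∑≤ n p + g (suc n)   ≡⟨ cong (_+_ (∑≤ n p)) gₙ₊₁≡0 ⟩
  ∑≤ n p + 0ℚ          ≡⟨ +-identityʳ (∑≤ n p) ⟩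
  ∑≤ n p               ∎
  where open ≡-Reasoning

∑₁≡∑≤ : ∀ n (f : ℕ → ℚ) → f 0 ≡ 0ℚ → ∑₁ n f ≡ ∑≤ n f
∑₁≡∑≤ zero    f f0≡0 = sym f0≡0
∑₁≡∑≤ (suc n) f f0≡0 = cong (_+ f (suc n)) (∑₁≡∑≤ n f f0≡0)

∑₁-cong : ∀ n {f g : ℕ → ℚ} → (∀ i → f i ≡ g i) → ∑₁ n f ≡ ∑₁ n g
∑₁-cong zero    eq = refl
∑₁-cong (suc n) eq = cong₂ _+_ (∑₁-cong n eq) (eq (suc n))

*-distribʳ-∑₁ : ∀ n c (f : ℕ → ℚ) → ∑₁ n f * c ≡ ∑₁ n (λ i → f i * c)
*-distribʳ-∑₁ zero    c f = *-zeroˡ c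
*-distribʳ-∑₁ (suc n) c f =
  trans (*-distribʳ-+ c (∑₁ n f) (f (suc n))) (cong (_+ f (suc n) * c) (*-distribʳ-∑₁ n c f))

δ : ℕ → ℕ → ℚ
δ zero    zero    = 1ℚ
δ zero    (suc _) = 0ℚ
δ (suc _) zero    = 0ℚ
δ (suc m) (suc n) = δ m n

δ-refl : ∀ n → δ n n ≡ 1ℚ
δ-refl zero    = refl
δ-refl (suc n) = δ-refl n

δ-≢ : ∀ {m n} → ¬ m ≡ n → δ m n ≡ 0ℚ
δ-≢ {zero}  {zero}  m≢n = ⊥-elim (m≢n refl)
δ-≢ {zero}  {suc n} _   = refl
δ-≢ {suc m} {zero}  _   = refl
δ-≢ {suc m} {suc n} m≢n = δ-≢ (λ m≡n → m≢n (cong suc m≡n))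

fromℕ-*-δ : ∀ m n → fromℕ m * δ m n ≡ fromℕ n * δ m n
fromℕ-*-δ m n with m ℕ.≟ n
... | yes refl = refl
... | no  m≢n  rewrite δ-≢ m≢n = trans (*-zeroʳ (fromℕ m)) (sym (*-zeroʳ (fromℕ n)))

∑≤-δ : ∀ n (f : ℕ → ℚ) → ∑≤ n (λ m → f m * δ m n) ≡ f n
∑≤-δ zero    f = *-identityʳ (f 0)
∑≤-δ (suc n) f = begin
  ∑≤ n (λ m → f m * δ m (suc n)) + f (suc n) * δ n n
    ≡⟨ cong₂ _+_ (∑≤-zero n (λ m m≤n → trans (cong (f m *_) (δ-≢ (ℕₚ.<⇒≢ (s≤s m≤n)))) (*-zeroʳ (f m))))
                 (trans (cong (f (suc n) *_) (δ-refl n)) (*-identityʳ (f (suc n)))) ⟩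
  0ℚ + f (suc n)  ≡⟨ +-identityˡ (f (suc n)) ⟩
  f (suc n)       ∎
  where open ≡-Reasoning

-- Operations on formal power series

infixl 6 _⊕_
infix  30 t·_ [1+t]·_

_⊕_ : Series → Series → Series
(f ⊕ g) n = f n + g n

scale : ℚ → Series → Series
scale c f n = c * f n

t·_ : Series → Series
(t· f) zero    = 0ℚ
(t· f) (suc n) = f n

[1+t]·_ : Series → Series
[1+t]· f = f ⊕ t· f

∂ : Series → Series
∂ f n = fromℕ (suc n) * f (suc n)

θ : Series → Series
θ f n = fromℕ n * f n

⊛-congˡ : ∀ {f f′} g → f ≗ f′ → f ⊛ g ≗ f′ ⊛ g
⊛-congˡ g eq n = ∑≤-cong n (λ i _ → cong (_* g (n ∸ i)) (eq i))

⊛-congʳ : ∀ f {g g′} → g ≗ g′ → f ⊛ g ≗ f ⊛ g′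
⊛-congʳ f eq n = ∑≤-cong n (λ i _ → cong (f i *_) (eq (n ∸ i)))

⊛-distribʳ-⊕ : ∀ f g h → (f ⊕ g) ⊛ h ≗ f ⊛ h ⊕ g ⊛ h
⊛-distribʳ-⊕ f g h n =
  trans (∑≤-cong n (λ i _ → *-distribʳ-+ (h (n ∸ i)) (f i) (g i)))
        (∑≤-distrib-+ n (λ i → f i * h (n ∸ i)) (λ i → g i * h (n ∸ i)))

⊛-distribˡ-⊕ : ∀ h f g → h ⊛ (f ⊕ g) ≗ h ⊛ f ⊕ h ⊛ g
⊛-distribˡ-⊕ h f g n =
  trans (∑≤-cong n (λ i _ → *-distribˡ-+ (h i) (f (n ∸ i)) (g (n ∸ i))))
        (∑≤-distrib-+ n (λ i → h i * f (n ∸ i)) (λ i → h i * g (n ∸ i)))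

⊛-scaleʳ : ∀ f c g → f ⊛ scale c g ≗ scale c (f ⊛ g)
⊛-scaleʳ f c g n =
  trans (∑≤-cong n (λ i _ → *-CS.x∙yz≈y∙xz (f i) c (g (n ∸ i)))) (sym (*-distribˡ-∑≤ n c (λ i → f i * g (n ∸ i))))

⊛-sucʳ : ∀ f g n → (f ⊛ g) (suc n) ≡ (f ⊛ (λ i → g (suc i))) n + f (suc n) * g 0
⊛-sucʳ f g n = cong₂ _+_
  (∑≤-cong n (λ i i≤n → cong (λ k → f i * g k) (ℕₚ.+-∸-assoc 1 i≤n)))
  (cong (λ k → f (suc n) * g k) (ℕₚ.n∸n≡0 n))

⊛-identityˡ : ∀ g → one ⊛ g ≗ g
⊛-identityˡ g zero    = *-identityˡ (g 0)
⊛-identityˡ g (suc n) = begin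
  (one ⊛ g) (suc n)                               ≡⟨ ∑≤-suc n (λ i → one i * g (suc n ∸ i)) ⟩
  1ℚ * g (suc n) + ∑≤ n (λ i → 0ℚ * g (n ∸ i))
    ≡⟨ cong₂ _+_ (*-identityˡ (g (suc n))) (∑≤-zero n (λ i _ → *-zeroˡ (g (n ∸ i)))) ⟩
  g (suc n) + 0ℚ                                  ≡⟨ +-identityʳ (g (suc n)) ⟩
  g (suc n)                                       ∎
  where open ≡-Reasoning

⊛-identityʳ : ∀ f → f ⊛ one ≗ f
⊛-identityʳ f zero    = *-identityʳ (f 0)
⊛-identityʳ f (suc n) = begin
  (f ⊛ one) (suc n)                               ≡⟨ ⊛-sucʳ f one n ⟩
  ∑≤ n (λ i → f i * 0ℚ) + f (suc n) * 1ℚ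
    ≡⟨ cong₂ _+_ (∑≤-zero n (λ i _ → *-zeroʳ (f i))) (*-identityʳ (f (suc n))) ⟩
  0ℚ + f (suc n)                                  ≡⟨ +-identityˡ (f (suc n)) ⟩
  f (suc n)                                       ∎
  where open ≡-Reasoning

t·-cong : ∀ {f g} → f ≗ g → t· f ≗ t· g
t·-cong eq zero    = refl
t·-cong eq (suc n) = eq n

t·-⊕ : ∀ f g → t· (f ⊕ g) ≗ t· f ⊕ t· g
t·-⊕ f g zero    = refl
t·-⊕ f g (suc n) = refl

t·-⊛ˡ : ∀ f g → t· f ⊛ g ≗ t· (f ⊛ g)
t·-⊛ˡ f g zero    = *-zeroˡ (g 0)
t·-⊛ˡ f g (suc n) =
  trans (∑≤-suc n (λ i → (t· f) i * g (suc n ∸ i)))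
        (trans (cong (_+ (f ⊛ g) n) (*-zeroˡ (g (suc n)))) (+-identityˡ ((f ⊛ g) n)))

⊛-t·ʳ : ∀ f g → f ⊛ t· g ≗ t· (f ⊛ g)
⊛-t·ʳ f g zero    = *-zeroʳ (f 0)
⊛-t·ʳ f g (suc n) =
  trans (⊛-sucʳ f (t· g) n) (trans (cong (_+_ ((f ⊛ g) n)) (*-zeroʳ (f (suc n)))) (+-identityʳ ((f ⊛ g) n)))

[1+t]·-cong : ∀ {f g} → f ≗ g → [1+t]· f ≗ [1+t]· g
[1+t]·-cong eq n = cong₂ _+_ (eq n) (t·-cong eq n)

[1+t]·-⊕ : ∀ f g → [1+t]· (f ⊕ g) ≗ [1+t]· f ⊕ [1+t]· g
[1+t]·-⊕ f g n =
  trans (cong (_+_ ((f ⊕ g) n)) (t·-⊕ f g n)) (+-CS.interchange (f n) (g n) ((t· f) n) ((t· g) n))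

[1+t]·-⊛ˡ : ∀ f g → [1+t]· (f ⊛ g) ≗ [1+t]· f ⊛ g
[1+t]·-⊛ˡ f g n = sym (trans (⊛-distribʳ-⊕ f (t· f) g n) (cong (_+_ ((f ⊛ g) n)) (t·-⊛ˡ f g n)))

[1+t]·-⊛ʳ : ∀ f g → [1+t]· (f ⊛ g) ≗ f ⊛ [1+t]· g
[1+t]·-⊛ʳ f g n = sym (trans (⊛-distribˡ-⊕ f g (t· g) n) (cong (_+_ ((f ⊛ g) n)) (⊛-t·ʳ f g n)))

θ≗t·∂ : ∀ f → θ f ≗ t· ∂ f
θ≗t·∂ f zero    = *-zeroˡ (f 0)
θ≗t·∂ f (suc n) = refl

θ-⊛ : ∀ f g → θ (f ⊛ g) ≗ θ f ⊛ g ⊕ f ⊛ θ g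
θ-⊛ f g n = begin
  fromℕ n * ∑≤ n h                                  ≡⟨ *-distribˡ-∑≤ n (fromℕ n) h ⟩
  ∑≤ n (λ i → fromℕ n * h i)                        ≡⟨ ∑≤-cong n split ⟩
  ∑≤ n (λ i → fromℕ i * f i * g (n ∸ i) + f i * (fromℕ (n ∸ i) * g (n ∸ i)))
    ≡⟨ ∑≤-distrib-+ n (λ i → fromℕ i * f i * g (n ∸ i)) (λ i → f i * (fromℕ (n ∸ i) * g (n ∸ i))) ⟩
  (θ f ⊛ g) n + (f ⊛ θ g) n                         ∎
  where
  open ≡-Reasoning
  h : ℕ → ℚ
  h i = f i * g (n ∸ i)
  split : ∀ i → i ≤ n → fromℕ n * h i ≡ fromℕ i * f i * g (n ∸ i) + f i * (fromℕ (n ∸ i) * g (n ∸ i))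
  split i i≤n = begin
    fromℕ n * h i                       ≡⟨ cong (λ k → fromℕ k * h i) (ℕₚ.m+[n∸m]≡n i≤n) ⟨
    fromℕ (i ℕ.+ (n ∸ i)) * h i         ≡⟨ cong (_* h i) (fromℕ-+ i (n ∸ i)) ⟩
    (fromℕ i + fromℕ (n ∸ i)) * h i     ≡⟨ solve 4 (λ a b x y → (a :+ b) :* (x :* y) := a :* x :* y :+ x :* (b :* y)) refl
                                                   (fromℕ i) (fromℕ (n ∸ i)) (f i) (g (n ∸ i)) ⟩
    fromℕ i * f i * g (n ∸ i) + f i * (fromℕ (n ∸ i) * g (n ∸ i)) ∎

∂-⊛ : ∀ f g → ∂ (f ⊛ g) ≗ ∂ f ⊛ g ⊕ f ⊛ ∂ g
∂-⊛ f g n = begin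
  θ (f ⊛ g) (suc n)                            ≡⟨ θ-⊛ f g (suc n) ⟩
  (θ f ⊛ g) (suc n) + (f ⊛ θ g) (suc n)
    ≡⟨ cong₂ _+_ (⊛-congˡ g (θ≗t·∂ f) (suc n)) (⊛-congʳ f (θ≗t·∂ g) (suc n)) ⟩
  (t· ∂ f ⊛ g) (suc n) + (f ⊛ t· ∂ g) (suc n)
    ≡⟨ cong₂ _+_ (t·-⊛ˡ (∂ f) g (suc n)) (⊛-t·ʳ f (∂ g) (suc n)) ⟩
  (∂ f ⊛ g) n + (f ⊛ ∂ g) n                    ∎
  where open ≡-Reasoning

∂-one : ∀ n → ∂ one n ≡ 0ℚ
∂-one n = *-zeroʳ (fromℕ (suc n))

pow-cong : ∀ {f g} → f ≗ g → ∀ m → pow f m ≗ pow g m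
pow-cong eq zero    n = refl
pow-cong {f} {g} eq (suc m) n = trans (⊛-congˡ (pow f m) eq n) (⊛-congʳ g (pow-cong eq m) n)

pow-vanish : ∀ f → f 0 ≡ 0ℚ → ∀ {m n} → n < m → pow f m n ≡ 0ℚ
pow-vanish f f0≡0 {suc m} {n} (s≤s n≤m) = ∑≤-zero n term
  where
  term : ∀ i → i ≤ n → f i * pow f m (n ∸ i) ≡ 0ℚ
  term zero    _    = trans (cong (_* pow f m n) f0≡0) (*-zeroˡ (pow f m n))
  term (suc i) 1+i≤n =
    trans (cong (f (suc i) *_) (pow-vanish f f0≡0 (ℕₚ.<-≤-trans (ℕₚ.∸-monoʳ-< (s≤s z≤n) 1+i≤n) n≤m)))
          (*-zeroʳ (f (suc i)))

⊛-scale-pow-pred : ∀ f k → f ⊛ scale (fromℕ k) (pow f (k ∸ 1)) ≗ scale (fromℕ k) (pow f k)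
⊛-scale-pow-pred f zero    n =
  trans (⊛-scaleʳ f 0ℚ one n) (trans (*-zeroˡ ((f ⊛ one) n)) (sym (*-zeroˡ (one n))))
⊛-scale-pow-pred f (suc k) = ⊛-scaleʳ f (fromℕ (suc k)) (pow f k)

X≗t·one : X ≗ t· one
X≗t·one zero          = refl
X≗t·one (suc zero)    = refl
X≗t·one (suc (suc n)) = refl

X-⊛ : ∀ h → X ⊛ h ≗ t· h
X-⊛ h n = trans (⊛-congˡ h X≗t·one n) (trans (t·-⊛ˡ one h n) (t·-cong (⊛-identityˡ h) n))

pow-X≡δ : ∀ m n → pow X m n ≡ δ m n
pow-X≡δ zero    zero    = refl
pow-X≡δ zero    (suc n) = refl
pow-X≡δ (suc m) zero    = X-⊛ (pow X m) zero
pow-X≡δ (suc m) (suc n) = trans (X-⊛ (pow X m) (suc n)) (pow-X≡δ m n)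

-- Composition f(g(t)); the truncation of the sum at k = n is exact when g 0 ≡ 0.
-- By definition, log1+ u is logCoeff ∘ₛ u.
_∘ₛ_ : Series → Series → Series
(f ∘ₛ g) n = ∑≤ n (λ k → f k * pow g k n)

∘ₛ-congˡ : ∀ {f f′} g → f ≗ f′ → f ∘ₛ g ≗ f′ ∘ₛ g
∘ₛ-congˡ g eq n = ∑≤-cong n (λ k _ → cong (_* pow g k n) (eq k))

∘ₛ-congʳ : ∀ f {g g′} → g ≗ g′ → f ∘ₛ g ≗ f ∘ₛ g′
∘ₛ-congʳ f eq n = ∑≤-cong n (λ k _ → cong (f k *_) (pow-cong eq k n))

∘ₛ-X : ∀ f → f ∘ₛ X ≗ f
∘ₛ-X f n = trans (∑≤-cong n (λ m _ → cong (f m *_) (pow-X≡δ m n))) (∑≤-δ n f)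

∘ₛ-∘ₛ : ∀ f {g} h → g 0 ≡ 0ℚ → ∀ j → ((f ∘ₛ g) ∘ₛ h) j ≡ ∑≤ j (λ m → f m * (pow g m ∘ₛ h) j)
∘ₛ-∘ₛ f {g} h g0≡0 j = begin
  ∑≤ j (λ k → ∑≤ k (λ m → f m * pow g m k) * pow h k j)
    ≡⟨ ∑≤-cong j (λ k k≤j → cong (_* pow h k j) (∑≤-extend (λ m → f m * pow g m k) k≤j (vanish k))) ⟩
  ∑≤ j (λ k → ∑≤ j (λ m → f m * pow g m k) * pow h k j)
    ≡⟨ ∑≤-cong j (λ k _ → *-distribʳ-∑≤ j (pow h k j) (λ m → f m * pow g m k)) ⟩
  ∑≤ j (λ k → ∑≤ j (λ m → f m * pow g m k * pow h k j))
    ≡⟨ ∑≤-comm j j (λ k m → f m * pow g m k * pow h k j) ⟩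
  ∑≤ j (λ m → ∑≤ j (λ k → f m * pow g m k * pow h k j))
    ≡⟨ ∑≤-cong j (λ m _ → trans (∑≤-cong j (λ k _ → *-assoc (f m) (pow g m k) (pow h k j)))
                                (sym (*-distribˡ-∑≤ j (f m) (λ k → pow g m k * pow h k j)))) ⟩
  ∑≤ j (λ m → f m * (pow g m ∘ₛ h) j) ∎
  where
  open ≡-Reasoning
  vanish : ∀ k m → k < m → f m * pow g m k ≡ 0ℚ
  vanish k m k<m = trans (cong (f m *_) (pow-vanish g g0≡0 k<m)) (*-zeroʳ (f m))

-- The differential equations of log(1+t) and eᵗ − 1

∂-pow : ∀ {f} → ∂ f ≗ one ⊕ f →
        ∀ k → ∂ (pow f k) ≗ scale (fromℕ k) (pow f (k ∸ 1)) ⊕ scale (fromℕ k) (pow f k)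
∂-pow hyp zero    n =
  trans (∂-one n) (sym (trans (cong₂ _+_ (*-zeroˡ (one n)) (*-zeroˡ (one n))) (+-identityʳ 0ℚ)))
∂-pow {f} hyp (suc k) n = begin
  ∂ (f ⊛ pow f k) n
    ≡⟨ ∂-⊛ f (pow f k) n ⟩
  (∂ f ⊛ pow f k) n + (f ⊛ ∂ (pow f k)) n
    ≡⟨ cong₂ _+_ (⊛-congˡ (pow f k) hyp n) (⊛-congʳ f (∂-pow hyp k) n) ⟩
  ((one ⊕ f) ⊛ pow f k) n + (f ⊛ (scale (fromℕ k) (pow f (k ∸ 1)) ⊕ scale (fromℕ k) (pow f k))) n
    ≡⟨ cong₂ _+_ (⊛-distribʳ-⊕ one f (pow f k) n)
                 (⊛-distribˡ-⊕ f (scale (fromℕ k) (pow f (k ∸ 1))) (scale (fromℕ k) (pow f k)) n) ⟩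
  ((one ⊛ pow f k) n + pow f (suc k) n)
    + ((f ⊛ scale (fromℕ k) (pow f (k ∸ 1))) n + (f ⊛ scale (fromℕ k) (pow f k)) n)
    ≡⟨ cong₂ _+_ (cong (_+ pow f (suc k) n) (⊛-identityˡ (pow f k) n))
                 (cong₂ _+_ (⊛-scale-pow-pred f k n) (⊛-scaleʳ f (fromℕ k) (pow f k) n)) ⟩
  (pow f k n + pow f (suc k) n) + (fromℕ k * pow f k n + fromℕ k * pow f (suc k) n)
    ≡⟨ +-CS.interchange (pow f k n) (pow f (suc k) n) (fromℕ k * pow f k n) (fromℕ k * pow f (suc k) n) ⟩
  (pow f k n + fromℕ k * pow f k n) + (pow f (suc k) n + fromℕ k * pow f (suc k) n)
    ≡⟨ cong₂ _+_ (fromℕ-suc-* k (pow f k n)) (fromℕ-suc-* k (pow f (suc k) n)) ⟨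
  fromℕ (suc k) * pow f k n + fromℕ (suc k) * pow f (suc k) n ∎
  where open ≡-Reasoning

[1+t]·∂-pow : ∀ {f} → [1+t]· ∂ f ≗ one →
              ∀ m → [1+t]· ∂ (pow f m) ≗ scale (fromℕ m) (pow f (m ∸ 1))
[1+t]·∂-pow hyp zero    zero    = refl
[1+t]·∂-pow hyp zero    (suc n) = trans (cong₂ _+_ (∂-one (suc n)) (∂-one n)) (sym (*-zeroˡ 0ℚ))
[1+t]·∂-pow {f} hyp (suc m) n = begin
  ([1+t]· ∂ (f ⊛ pow f m)) n
    ≡⟨ [1+t]·-cong (∂-⊛ f (pow f m)) n ⟩
  ([1+t]· (∂ f ⊛ pow f m ⊕ f ⊛ ∂ (pow f m))) n
    ≡⟨ [1+t]·-⊕ (∂ f ⊛ pow f m) (f ⊛ ∂ (pow f m)) n ⟩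
  ([1+t]· (∂ f ⊛ pow f m)) n + ([1+t]· (f ⊛ ∂ (pow f m))) n
    ≡⟨ cong₂ _+_ ([1+t]·-⊛ˡ (∂ f) (pow f m) n) ([1+t]·-⊛ʳ f (∂ (pow f m)) n) ⟩
  ([1+t]· ∂ f ⊛ pow f m) n + (f ⊛ [1+t]· ∂ (pow f m)) n
    ≡⟨ cong₂ _+_ (⊛-congˡ (pow f m) hyp n) (⊛-congʳ f ([1+t]·∂-pow hyp m) n) ⟩
  (one ⊛ pow f m) n + (f ⊛ scale (fromℕ m) (pow f (m ∸ 1))) n
    ≡⟨ cong₂ _+_ (⊛-identityˡ (pow f m) n) (⊛-scale-pow-pred f m n) ⟩
  pow f m n + fromℕ m * pow f m n
    ≡⟨ fromℕ-suc-* m (pow f m n) ⟨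
  fromℕ (suc m) * pow f m n ∎
  where open ≡-Reasoning

∂-expm1 : ∂ expm1 ≗ one ⊕ expm1
∂-expm1 zero    = refl
∂-expm1 (suc n) =
  trans (fromℕ[m]*1/[m*n]≡1/n (suc (suc n)) (suc n !) {{_}} {{suc n ℕₚ.!≢0}}) (sym (+-identityˡ (expm1 (suc n))))

alt : ℕ → ℚ
alt zero    = 1ℚ
alt (suc n) = - alt n

%2-suc-suc : ∀ n → suc (suc n) ℕ.% 2 ≡ n ℕ.% 2
%2-suc-suc n = trans (cong (ℕ._% 2) (ℕₚ.+-comm 2 n)) ([m+n]%n≡m%n n 2)

alt-even : ∀ n → n ℕ.% 2 ≡ 0 → alt n ≡ 1ℚ
alt-even zero          _  = refl
alt-even (suc (suc n)) eq = trans (⁻¹-involutive (alt n)) (alt-even n (trans (sym (%2-suc-suc n)) eq))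

alt-odd : ∀ n {r} → n ℕ.% 2 ≡ suc r → alt n ≡ - 1ℚ
alt-odd (suc zero)    _  = refl
alt-odd (suc (suc n)) eq = trans (⁻¹-involutive (alt n)) (alt-odd n (trans (sym (%2-suc-suc n)) eq))

logCoeff-suc : ∀ n → logCoeff (suc n) ≡ alt n * (+ 1 / suc n)
logCoeff-suc n with n ℕ.% 2 in eq
... | zero  = trans (sym (*-identityˡ (+ 1 / suc n))) (cong (_* (+ 1 / suc n)) (sym (alt-even n eq)))
... | suc _ = trans (trans (cong -_ (sym (*-identityˡ (+ 1 / suc n)))) (neg-distribˡ-* 1ℚ (+ 1 / suc n)))
                    (cong (_* (+ 1 / suc n)) (sym (alt-odd n eq)))

∂-logCoeff : ∀ n → ∂ logCoeff n ≡ alt n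
∂-logCoeff n = begin
  fromℕ (suc n) * logCoeff (suc n)          ≡⟨ cong (fromℕ (suc n) *_) (logCoeff-suc n) ⟩
  fromℕ (suc n) * (alt n * (+ 1 / suc n))   ≡⟨ *-CS.x∙yz≈y∙xz (fromℕ (suc n)) (alt n) (+ 1 / suc n) ⟩
  alt n * (fromℕ (suc n) * (+ 1 / suc n))   ≡⟨ cong (alt n *_) (fromℕ[n]*1/n≡1 (suc n)) ⟩
  alt n * 1ℚ                                ≡⟨ *-identityʳ (alt n) ⟩
  alt n                                     ∎
  where open ≡-Reasoning

[1+t]·∂-logCoeff : [1+t]· ∂ logCoeff ≗ one
[1+t]·∂-logCoeff zero    = trans (+-identityʳ (∂ logCoeff 0)) (∂-logCoeff 0)
[1+t]·∂-logCoeff (suc n) = trans (cong₂ _+_ (∂-logCoeff (suc n)) (∂-logCoeff n)) (+-inverseˡ (alt n))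

-- Inversion

pow-logCoeff-rec : ∀ m j → fromℕ (suc j) * pow logCoeff (suc m) (suc j) + fromℕ j * pow logCoeff (suc m) j
                           ≡ fromℕ (suc m) * pow logCoeff m j
pow-logCoeff-rec m zero    =
  trans (cong (_+_ (fromℕ 1 * pow logCoeff (suc m) 1)) (*-zeroˡ (pow logCoeff (suc m) 0)))
        ([1+t]·∂-pow [1+t]·∂-logCoeff (suc m) 0)
pow-logCoeff-rec m (suc j) = [1+t]·∂-pow [1+t]·∂-logCoeff (suc m) (suc j)

pow-expm1-rec : ∀ k j → fromℕ (suc j) * pow expm1 (suc k) (suc j)
                        ≡ fromℕ (suc k) * pow expm1 k j + fromℕ (suc k) * pow expm1 (suc k) j
pow-expm1-rec k = ∂-pow ∂-expm1 (suc k)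

pow-logCoeff-∘ₛ-expm1-suc : ∀ m j → fromℕ (suc j) * (pow logCoeff (suc m) ∘ₛ expm1) (suc j)
                                    ≡ fromℕ (suc m) * (pow logCoeff m ∘ₛ expm1) j
pow-logCoeff-∘ₛ-expm1-suc m j = begin
  fromℕ (suc j) * ∑≤ (suc j) (λ k → a k * b k (suc j))
    ≡⟨ trans (*-distribˡ-∑≤ (suc j) (fromℕ (suc j)) (λ k → a k * b k (suc j)))
             (∑≤-suc j (λ k → fromℕ (suc j) * (a k * b k (suc j)))) ⟩
  fromℕ (suc j) * (a 0 * 0ℚ) + ∑≤ j x
    ≡⟨ cong (_+ ∑≤ j x) (trans (cong (fromℕ (suc j) *_) (*-zeroʳ (a 0))) (*-zeroʳ (fromℕ (suc j)))) ⟩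
  0ℚ + ∑≤ j x      ≡⟨ +-identityˡ (∑≤ j x) ⟩
  ∑≤ j x           ≡⟨ ∑≤-telescope-vanishing j g-start g-end step ⟩
  ∑≤ j p           ≡⟨ *-distribˡ-∑≤ j (fromℕ (suc m)) (λ k → pow logCoeff m k * b k j) ⟨
  fromℕ (suc m) * (pow logCoeff m ∘ₛ expm1) j ∎
  where
  open ≡-Reasoning
  a : ℕ → ℚ
  a = pow logCoeff (suc m)
  b : ℕ → ℕ → ℚ
  b = pow expm1
  x g p : ℕ → ℚ
  x k = fromℕ (suc j) * (a (suc k) * b (suc k) (suc j))
  g k = fromℕ k * a k * b k j
  p k = fromℕ (suc m) * (pow logCoeff m k * b k j)
  g-start : g 0 ≡ 0ℚ
  g-start = trans (cong (_* b 0 j) (*-zeroˡ (a 0))) (*-zeroˡ (b 0 j))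
  g-end : g (suc j) ≡ 0ℚ
  g-end = trans (cong (fromℕ (suc j) * a (suc j) *_) (pow-vanish expm1 refl {suc j} {j} ℕₚ.≤-refl))
                (*-zeroʳ (fromℕ (suc j) * a (suc j)))
  step : ∀ k → k ≤ j → x k + g k ≡ p k + g (suc k)
  step k _ = begin
    fromℕ (suc j) * (a (suc k) * b (suc k) (suc j)) + g k
      ≡⟨ cong (_+ g k) (*-CS.x∙yz≈y∙xz (fromℕ (suc j)) (a (suc k)) (b (suc k) (suc j))) ⟩
    a (suc k) * (fromℕ (suc j) * b (suc k) (suc j)) + g k
      ≡⟨ cong (λ y → a (suc k) * y + g k) (pow-expm1-rec k j) ⟩
    a (suc k) * (fromℕ (suc k) * b k j + fromℕ (suc k) * b (suc k) j) + fromℕ k * a k * b k j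
      ≡⟨ solve 6 (λ a₁ q b₀ b₁ r a₀ → a₁ :* (q :* b₀ :+ q :* b₁) :+ r :* a₀ :* b₀
                                      := (q :* a₁ :+ r :* a₀) :* b₀ :+ q :* a₁ :* b₁)
                 refl (a (suc k)) (fromℕ (suc k)) (b k j) (b (suc k) j) (fromℕ k) (a k) ⟩
    (fromℕ (suc k) * a (suc k) + fromℕ k * a k) * b k j + g (suc k)
      ≡⟨ cong (λ y → y * b k j + g (suc k)) (pow-logCoeff-rec m k) ⟩
    fromℕ (suc m) * pow logCoeff m k * b k j + g (suc k)
      ≡⟨ cong (_+ g (suc k)) (*-assoc (fromℕ (suc m)) (pow logCoeff m k) (b k j)) ⟩
    p k + g (suc k) ∎

pow-logCoeff-∘ₛ-expm1 : ∀ m j → (pow logCoeff m ∘ₛ expm1) j ≡ δ m j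
pow-logCoeff-∘ₛ-expm1 zero    zero    = refl
pow-logCoeff-∘ₛ-expm1 zero    (suc j) =
  trans (∑≤-suc j (λ k → one k * pow expm1 k (suc j)))
        (trans (cong (_+_ 0ℚ) (∑≤-zero j (λ k _ → *-zeroˡ (pow expm1 (suc k) (suc j))))) (+-identityʳ 0ℚ))
pow-logCoeff-∘ₛ-expm1 (suc m) zero    =
  trans (*-identityʳ (pow logCoeff (suc m) 0)) (pow-vanish logCoeff refl {suc m} {0} (s≤s z≤n))
pow-logCoeff-∘ₛ-expm1 (suc m) (suc j) = fromℕ-suc-*-cancelˡ j (begin
  fromℕ (suc j) * (pow logCoeff (suc m) ∘ₛ expm1) (suc j)  ≡⟨ pow-logCoeff-∘ₛ-expm1-suc m j ⟩
  fromℕ (suc m) * (pow logCoeff m ∘ₛ expm1) j              ≡⟨ cong (fromℕ (suc m) *_) (pow-logCoeff-∘ₛ-expm1 m j) ⟩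
  fromℕ (suc m) * δ m j                                     ≡⟨ fromℕ-*-δ (suc m) (suc j) ⟩
  fromℕ (suc j) * δ m j                                     ∎)
  where open ≡-Reasoning

∘ₛ-logCoeff-∘ₛ-expm1 : ∀ f → (f ∘ₛ logCoeff) ∘ₛ expm1 ≗ f
∘ₛ-logCoeff-∘ₛ-expm1 f j = begin
  ((f ∘ₛ logCoeff) ∘ₛ expm1) j
    ≡⟨ ∘ₛ-∘ₛ f expm1 refl j ⟩
  ∑≤ j (λ m → f m * (pow logCoeff m ∘ₛ expm1) j)
    ≡⟨ ∑≤-cong j (λ m _ → cong (f m *_) (pow-logCoeff-∘ₛ-expm1 m j)) ⟩
  ∑≤ j (λ m → f m * δ m j)
    ≡⟨ ∑≤-δ j f ⟩
  f j ∎
  where open ≡-Reasoning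

fact-*-S₂ : ∀ j k → fact k * S₂ j k ≡ fact j * pow expm1 k j
fact-*-S₂ j k = begin
  fact k * (fact j * (u * pow expm1 k j))   ≡⟨ *-CS.x∙yz≈y∙xz (fact k) (fact j) (u * pow expm1 k j) ⟩
  fact j * (fact k * (u * pow expm1 k j))   ≡⟨ cong (fact j *_) (*-assoc (fact k) u (pow expm1 k j)) ⟨
  fact j * (fact k * u * pow expm1 k j)
    ≡⟨ cong (λ y → fact j * (y * pow expm1 k j)) (fromℕ[n]*1/n≡1 (k !) {{k ℕₚ.!≢0}}) ⟩
  fact j * (1ℚ * pow expm1 k j)             ≡⟨ cong (fact j *_) (*-identityˡ (pow expm1 k j)) ⟩
  fact j * pow expm1 k j                    ∎
  where
  open ≡-Reasoning
  u = (+ 1 / (k !)) {{k ℕₚ.!≢0}}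

∑₁-bel-S₂ : ∀ j → ∑₁ j (λ k → bel k * S₂ j k) ≡ fact j * logCoeff j
∑₁-bel-S₂ j = begin
  ∑₁ j (λ k → bel k * S₂ j k)
    ≡⟨ ∑₁≡∑≤ j (λ k → bel k * S₂ j k) (*-zeroˡ (S₂ j 0)) ⟩
  ∑≤ j (λ k → fact k * b k * S₂ j k)
    ≡⟨ ∑≤-cong j (λ k _ → regroup k) ⟩
  ∑≤ j (λ k → fact j * (b k * pow expm1 k j))
    ≡⟨ *-distribˡ-∑≤ j (fact j) (λ k → b k * pow expm1 k j) ⟨
  fact j * (b ∘ₛ expm1) j
    ≡⟨ cong (fact j *_) (∘ₛ-congˡ expm1 (∘ₛ-congʳ logCoeff (∘ₛ-X logCoeff)) j) ⟩
  fact j * ((logCoeff ∘ₛ logCoeff) ∘ₛ expm1) j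
    ≡⟨ cong (fact j *_) (∘ₛ-logCoeff-∘ₛ-expm1 logCoeff j) ⟩
  fact j * logCoeff j ∎
  where
  open ≡-Reasoning
  b : Series
  b = log1+ (log1+ X)
  regroup : ∀ k → fact k * b k * S₂ j k ≡ fact j * (b k * pow expm1 k j)
  regroup k = begin
    fact k * b k * S₂ j k              ≡⟨ *-CS.xy∙z≈y∙xz (fact k) (b k) (S₂ j k) ⟩
    b k * (fact k * S₂ j k)            ≡⟨ cong (b k *_) (fact-*-S₂ j k) ⟩
    b k * (fact j * pow expm1 k j)     ≡⟨ *-CS.x∙yz≈y∙xz (b k) (fact j) (pow expm1 k j) ⟩
    fact j * (b k * pow expm1 k j)     ∎

∑₁-fact-logCoeff-S₂ : ∀ {n} → 2 ≤ n → ∑₁ n (λ j → fact j * logCoeff j * S₂ n j) ≡ 0ℚ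
∑₁-fact-logCoeff-S₂ {suc (suc n)} (s≤s (s≤s z≤n)) = begin
  ∑₁ N (λ j → fact j * logCoeff j * S₂ N j)
    ≡⟨ ∑₁≡∑≤ N (λ j → fact j * logCoeff j * S₂ N j) (*-zeroˡ (S₂ N 0)) ⟩
  ∑≤ N (λ j → fact j * logCoeff j * S₂ N j)
    ≡⟨ ∑≤-cong N (λ j _ → regroup j) ⟩
  ∑≤ N (λ j → fact N * (logCoeff j * pow expm1 j N))
    ≡⟨ *-distribˡ-∑≤ N (fact N) (λ j → logCoeff j * pow expm1 j N) ⟨
  fact N * (logCoeff ∘ₛ expm1) N
    ≡⟨ cong (fact N *_) (∘ₛ-congˡ expm1 (⊛-identityʳ logCoeff) N) ⟨
  fact N * (pow logCoeff 1 ∘ₛ expm1) N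
    ≡⟨ cong (fact N *_) (pow-logCoeff-∘ₛ-expm1 1 N) ⟩
  fact N * 0ℚ
    ≡⟨ *-zeroʳ (fact N) ⟩
  0ℚ ∎
  where
  open ≡-Reasoning
  N = suc (suc n)
  regroup : ∀ j → fact j * logCoeff j * S₂ N j ≡ fact N * (logCoeff j * pow expm1 j N)
  regroup j = begin
    fact j * logCoeff j * S₂ N j             ≡⟨ *-CS.xy∙z≈y∙xz (fact j) (logCoeff j) (S₂ N j) ⟩
    logCoeff j * (fact j * S₂ N j)           ≡⟨ cong (logCoeff j *_) (fact-*-S₂ N j) ⟩
    logCoeff j * (fact N * pow expm1 j N)    ≡⟨ *-CS.x∙yz≈y∙xz (logCoeff j) (fact N) (pow expm1 j N) ⟩
    fact N * (logCoeff j * pow expm1 j N)    ∎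

theorem3 : (bel 1 ≡ 1ℚ)
    × ((n : ℕ) → 2 ≤ n →
        ∑₁ n (λ j → ∑₁ j (λ k → bel k * S₂ j k * S₂ n j)) ≡ 0ℚ)
theorem3 = refl , λ n 2≤n → begin
  ∑₁ n (λ j → ∑₁ j (λ k → bel k * S₂ j k * S₂ n j))
    ≡⟨ ∑₁-cong n (λ j → *-distribʳ-∑₁ j (S₂ n j) (λ k → bel k * S₂ j k)) ⟨
  ∑₁ n (λ j → ∑₁ j (λ k → bel k * S₂ j k) * S₂ n j)
    ≡⟨ ∑₁-cong n (λ j → cong (_* S₂ n j) (∑₁-bel-S₂ j)) ⟩
  ∑₁ n (λ j → fact j * logCoeff j * S₂ n j)
    ≡⟨ ∑₁-fact-logCoeff-S₂ 2≤n ⟩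
  0ℚ ∎
  where open ≡-Reasoning
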